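{- Let $p$ be a prime, $K$ a finite extension of $\mathbb{Q}_p$ with maximal ideal $\mathfrak{p}$ of $\mathcal{O}_K$. Let $x \in K$ be nonzero with $\nu_{\mathfrak{p}}(x) = bp^{k}$ where $b\in\mathbb{Q}$, $\nu_p(b) = 0$ and $k$ is an integer with $1 \leq k \leq p$. Then the $\nu_{\mathfrak{p}}$ sequence and the $\mathrm{inc}_{\mathfrak{p}}$ sequence of $x$ are periodic of period $k$.
   Context: $\nu_{\mathfrak{p}}$ is the unique discrete valuation on $K$ extending the $p$-adic valuation $\nu_p$ (so $\nu_{\mathfrak{p}}(p)=1$). $D_{K,\mathfrak{p}}(x) = x\,\nu_{\mathfrak{p}}(x)/p$ for $x\neq 0$, $D_{K,\mathfrak{p}}(0)=0$; $D^i_{K,\mathfrak{p}}$ is the $i$-th iterate. The $\nu_{\mathfrak{p}}$ sequence of $x$ is $(\nu_{\mathfrak{p}}(D^i_{K,\mathfrak{p}}(x)))_{i\ge 0}$, and the $\mathrm{inc}_{\mathfrak{p}}$ sequence of $x$ is $(\nu_{\mathfrak{p}}(D^{i+1}_{K,\mathfrak{p}}(x)) - \nu_{\mathfrak{p}}(D^{i}_{K,\mathfrak{p}}(x)))_{i \ge 0}$. -}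

module Defs where

open import Level using (0ℓ)
open import Data.Nat as ℕ using (ℕ; zero; suc; _∸_; NonZero)
open import Data.Nat.Divisibility using (_∣?_)
open import Data.Nat.DivMod using (_/_)
open import Data.Nat.Primality using (Prime; prime⇒nonZero)
open import Data.Integer as ℤ using (ℤ; +_; ∣_∣)
open import Data.Rational as ℚ using (ℚ; 0ℚ; 1ℚ; _≤_; _*_; _+_; _-_)
open import Data.Product using (Σ; ∃; _×_; _,_)
open import Data.Sum using (_⊎_)
open import Algebra.Bundles using (CommutativeRing)
open import Relation.Nullary using (¬_; yes; no)
open import Relation.Binary.PropositionalEquality using (_≡_; _≢_)
open import Function using (_∘_)

-- p-adic valuation on ℕ and on ℚ (value at 0 is junk = 0; every use
-- below is guarded by an explicit nonzeroness hypothesis).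

-- number of times p divides n, computed with fuel n (enough for p ≥ 2)
valℕ-fuel : (p : ℕ) → .{{NonZero p}} → ℕ → ℕ → ℕ
valℕ-fuel p zero    n = zero
valℕ-fuel p (suc f) zero = zero
valℕ-fuel p (suc f) (suc n) with p ∣? suc n
... | yes _ = suc (valℕ-fuel p f (suc n / p))
... | no  _ = zero

valℕ : (p : ℕ) → .{{NonZero p}} → ℕ → ℕ
valℕ p n = valℕ-fuel p n n

ν-p : (p : ℕ) → .{{NonZero p}} → ℚ → ℤ
ν-p p q = + valℕ p ∣ ℚ.numerator q ∣ ℤ.- + valℕ p (ℚ.denominatorℕ q)

ℤtoℚ : ℤ → ℚ
ℤtoℚ z = z ℚ./ 1

ℕtoℚ : ℕ → ℚ
ℕtoℚ n = ℤtoℚ (+ n)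

-- A field K ⊇ ℚ with a discrete valuation ν_𝔭 : K → ℚ extending ν_p.
-- (Abstract stand-in for "finite extension of ℚ_p with its unique
-- normalised-at-p valuation".)

record PAdicValuedField (p : ℕ) : Set₁ where
  field
    Kring : CommutativeRing 0ℓ 0ℓ
  open CommutativeRing Kring public
    renaming (_+_ to _+K_; _*_ to _*K_; 0# to 0K; 1# to 1K)
  field
    1≉0     : ¬ (1K ≈ 0K)
    inverse : ∀ x → ¬ (x ≈ 0K) → ∃ λ y → (x *K y) ≈ 1K
    ι       : ℚ → Carrier
    ι-+     : ∀ q r → ι (q ℚ.+ r) ≈ (ι q +K ι r)
    ι-*     : ∀ q r → ι (q ℚ.* r) ≈ (ι q *K ι r)
    ι-1     : ι 1ℚ ≈ 1K
    -- the valuation ν_𝔭 (meaningful on nonzero elements)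
    ν       : Carrier → ℚ
    ν-cong  : ∀ {x y} → x ≈ y → ν x ≡ ν y
    ν-*     : ∀ x y → ¬ (x ≈ 0K) → ¬ (y ≈ 0K) → ν (x *K y) ≡ ν x ℚ.+ ν y
    ν-+     : ∀ x y → ¬ (x ≈ 0K) → ¬ (y ≈ 0K) → ¬ ((x +K y) ≈ 0K) →
              (ν x ℚ.≤ ν (x +K y)) ⊎ (ν y ℚ.≤ ν (x +K y))
    e       : ℕ
    e-pos   : 1 ℕ.≤ e
    ν-disc  : ∀ x → ¬ (x ≈ 0K) → ∃ λ (n : ℤ) → ν x ℚ.* ℕtoℚ e ≡ ℤtoℚ n
    ν-ext   : (hp : Prime p) (q : ℚ) → q ≢ 0ℚ →
              ν (ι q) ≡ ℤtoℚ (ν-p p {{prime⇒nonZero hp}} q)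

module _ {p : ℕ} (hp : Prime p) (K : PAdicValuedField p) where
  open PAdicValuedField K

  private
    instance
      p≢0 : NonZero p
      p≢0 = prime⇒nonZero hp

  -- D_{K,𝔭}(x) = x ν_𝔭(x) / p   (D(0) = 0 * … = 0 automatically)
  D : Carrier → Carrier
  D x = x *K ι (ν x ℚ.* (+ 1 ℚ./ p))

  iterD : ℕ → Carrier → Carrier
  iterD zero    x = x
  iterD (suc i) x = D (iterD i x)

  νSeq : Carrier → ℕ → ℚ
  νSeq x i = ν (iterD i x)

  incSeq : Carrier → ℕ → ℚ
  incSeq x i = νSeq x (suc i) ℚ.- νSeq x i

HasPeriod : {A : Set} → (ℕ → A) → ℕ → Set
HasPeriod s k = ∀ i → s (k ℕ.+ i) ≡ s i

PeriodicOfPeriod : {A : Set} → (ℕ → A) → ℕ → Set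
PeriodicOfPeriod s k =
  1 ℕ.≤ k × HasPeriod s k × (∀ j → 1 ℕ.≤ j → j ℕ.< k → ¬ HasPeriod s j)

{-# OPTIONS --safe #-}
-- Write v₀ = ν(x) = b pᵏ. If ν(y) = v₀ + m with 0 ≤ m < k, then ν(D y) = ν(y) + ν_p((v₀ + m)/p).
-- For m = 0 this is v₀ + (k − 1), as ν_p(v₀) = k. For 0 < m < k ≤ p the integer m is a p-adic
-- unit, so ν_p(v₀ + m) = 0 and ν(D y) = v₀ + (m − 1). Hence ν(Dⁱ x) = v₀ + cᵢ where cᵢ runs
-- through 0, k − 1, k − 2, …, 1, 0, …, and both the valuations and their increments
-- k − 1, −1, …, −1 repeat with exact period k.
module Submission where

open import Defs
open import Data.Nat using (ℕ; suc; _≤_; _^_)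
open import Data.Nat.Primality using (Prime; prime⇒nonZero)
open import Data.Integer using (+_)
open import Data.Rational as ℚ using (ℚ; 0ℚ)
open import Relation.Nullary using (¬_)
open import Relation.Binary.PropositionalEquality using (_≡_; _≢_)

module Multiplicity where

  open import Data.Nat
  open import Data.Nat.Properties
  open import Data.Nat.Divisibility using (_∣_; _∤_; divides; _∣?_; _∣0; m∣m*n; ∣m⇒∣m*n)
  open import Data.Nat.DivMod using (_/_; m*n/n≡m)
  open import Data.Nat.Primality using (prime⇒nonTrivial; euclidsLemma)
  open import Data.Nat.Coprimality using (Coprime)
  open import Data.Product using (∃-syntax; _×_; _,_)
  open import Data.Sum using (inj₁; inj₂; [_,_]′)
  open import Function using (_∘_)
  open import Relation.Nullary using (yes; no; contradiction)
  open import Algebra.Properties.CommutativeSemigroup *-commutativeSemigroup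
    using () renaming (interchange to *-interchange)
  open import Relation.Binary.PropositionalEquality
  open ≡-Reasoning

  module _ {p : ℕ} (1<p : 1 < p) where

    private instance
      p≢0 : NonZero p
      p≢0 = >-nonZero (<-trans z<s 1<p)

    p^a*r≢0 : ∀ a {r} → p ∤ r → p ^ a * r ≢ 0
    p^a*r≢0 a p∤r eq with m*n≡0⇒m≡0∨n≡0 (p ^ a) eq
    ... | inj₁ p^a≡0 = ≢-nonZero⁻¹ (p ^ a) {{m^n≢0 p a}} p^a≡0
    ... | inj₂ refl  = p∤r (p ∣0)

    p^a*r*p≡p^[1+a]*r : ∀ a r → p ^ a * r * p ≡ p ^ suc a * r
    p^a*r*p≡p^[1+a]*r a r = begin
      p ^ a * r * p   ≡⟨ *-assoc (p ^ a) r p ⟩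
      p ^ a * (r * p) ≡⟨ cong (p ^ a *_) (*-comm r p) ⟩
      p ^ a * (p * r) ≡⟨ *-assoc (p ^ a) p r ⟨
      p ^ a * p * r   ≡⟨ cong (_* r) (*-comm (p ^ a) p) ⟩
      p ^ suc a * r   ∎

    quotient≢0 : ∀ {n q} → suc n ≡ q * p → q ≢ 0
    quotient≢0 n≡qp refl = 1+n≢0 n≡qp

    quotient< : ∀ {n q} → suc n ≡ q * p → q < suc n
    quotient< {q = q} n≡qp = subst (q <_) (sym n≡qp) (m<m*n q p {{≢-nonZero (quotient≢0 n≡qp)}} 1<p)

    valℕ-fuel-factorisation : ∀ f n → n ≤ f → n ≢ 0 →
      ∃[ r ] n ≡ p ^ valℕ-fuel p f n * r × p ∤ r
    valℕ-fuel-factorisation zero    zero    _ n≢0 = contradiction refl n≢0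
    valℕ-fuel-factorisation (suc f) zero    _ n≢0 = contradiction refl n≢0
    valℕ-fuel-factorisation (suc f) (suc n) n≤f _ with p ∣? suc n
    ... | no  p∤n = suc n , sym (*-identityˡ (suc n)) , p∤n
    ... | yes (divides q n≡qp)
      with valℕ-fuel-factorisation f q (≤-pred (≤-trans (quotient< n≡qp) n≤f)) (quotient≢0 n≡qp)
    ...   | r , q≡p^v*r , p∤r = r , n≡ , p∤r
      where
        n≡ : suc n ≡ p ^ suc (valℕ-fuel p f (suc n / p)) * r
        n≡ = begin
          suc n                                   ≡⟨ n≡qp ⟩
          q * p                                   ≡⟨ cong (_* p) q≡p^v*r ⟩
          p ^ valℕ-fuel p f q * r * p             ≡⟨ p^a*r*p≡p^[1+a]*r (valℕ-fuel p f q) r ⟩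
          p ^ suc (valℕ-fuel p f q) * r           ≡⟨ cong (λ t → p ^ suc (valℕ-fuel p f t) * r) (trans (cong (_/ p) n≡qp) (m*n/n≡m q p)) ⟨
          p ^ suc (valℕ-fuel p f (suc n / p)) * r ∎

    valℕ-factorisation : ∀ n → n ≢ 0 → ∃[ r ] n ≡ p ^ valℕ p n * r × p ∤ r
    valℕ-factorisation n = valℕ-fuel-factorisation n n ≤-refl

    p∣p^[1+a]*r : ∀ a r → p ∣ p ^ suc a * r
    p∣p^[1+a]*r a r = ∣m⇒∣m*n r (m∣m*n (p ^ a))

    p^a*r≡p^b*s⇒a≡b : ∀ a b {r s} → p ^ a * r ≡ p ^ b * s → p ∤ r → p ∤ s → a ≡ b
    p^a*r≡p^b*s⇒a≡b zero    zero    _  _   _   = refl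
    p^a*r≡p^b*s⇒a≡b zero    (suc b) {r} eq p∤r _ =
      contradiction (subst (p ∣_) (trans (sym eq) (*-identityˡ r)) (p∣p^[1+a]*r b _)) p∤r
    p^a*r≡p^b*s⇒a≡b (suc a) zero    {s = s} eq _ p∤s =
      contradiction (subst (p ∣_) (trans eq (*-identityˡ s)) (p∣p^[1+a]*r a _)) p∤s
    p^a*r≡p^b*s⇒a≡b (suc a) (suc b) {r} {s} eq p∤r p∤s =
      cong suc (p^a*r≡p^b*s⇒a≡b a b (*-cancelˡ-≡ _ _ p (begin
        p * (p ^ a * r) ≡⟨ *-assoc p _ r ⟨
        p ^ suc a * r   ≡⟨ eq ⟩
        p ^ suc b * s   ≡⟨ *-assoc p _ s ⟩
        p * (p ^ b * s) ∎)) p∤r p∤s)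

    valℕ-unique : ∀ {n} a {r} → n ≡ p ^ a * r → p ∤ r → valℕ p n ≡ a
    valℕ-unique a {r} refl p∤r =
      let s , n≡ , p∤s = valℕ-factorisation (p ^ a * r) (p^a*r≢0 a p∤r)
      in p^a*r≡p^b*s⇒a≡b _ a (sym n≡) p∤s p∤r

    ∤⇒valℕ≡0 : ∀ {n} → p ∤ n → valℕ p n ≡ 0
    ∤⇒valℕ≡0 {n} p∤n = valℕ-unique 0 (sym (*-identityˡ n)) p∤n

    ∣⇒valℕ≢0 : ∀ {n} → n ≢ 0 → p ∣ n → valℕ p n ≢ 0
    ∣⇒valℕ≢0 {n} n≢0 p∣n v≡0 with valℕ-factorisation n n≢0
    ... | r , n≡ , p∤r =
      p∤r (subst (p ∣_) (trans n≡ (trans (cong (λ v → p ^ v * r) v≡0) (*-identityˡ r))) p∣n)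

    valℕ≢0⇒∣ : ∀ {n} → valℕ p n ≢ 0 → p ∣ n
    valℕ≢0⇒∣ {zero}        _   = p ∣0
    valℕ≢0⇒∣ {n@(suc _)} v≢0 with valℕ-factorisation n (λ ())
    ... | r , n≡ , _ with valℕ p n
    ...   | zero  = contradiction refl v≢0
    ...   | suc v = subst (p ∣_) (sym n≡) (p∣p^[1+a]*r v r)

    coprime⇒valℕ≡⇒∤ : ∀ {m n} → Coprime m n → m ≢ 0 → valℕ p m ≡ valℕ p n → p ∤ m
    coprime⇒valℕ≡⇒∤ coprime m≢0 v≡ p∣m =
      >⇒≢ 1<p (coprime (p∣m , valℕ≢0⇒∣ (subst (_≢ 0) v≡ (∣⇒valℕ≢0 m≢0 p∣m))))

  module _ {p : ℕ} (prime : Prime p) where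

    private instance
      p≢0 : NonZero p
      p≢0 = prime⇒nonZero prime

    private
      1<p : 1 < p
      1<p = nonTrivial⇒n>1 p {{prime⇒nonTrivial prime}}

    valℕ-* : ∀ {m n} → m ≢ 0 → n ≢ 0 → valℕ p (m * n) ≡ valℕ p m + valℕ p n
    valℕ-* {m} {n} m≢0 n≢0 with valℕ-factorisation 1<p m m≢0 | valℕ-factorisation 1<p n n≢0
    ... | r , m≡ , p∤r | s , n≡ , p∤s = valℕ-unique 1<p (valℕ p m + valℕ p n) mn≡ p∤rs
      where
        a b : ℕ
        a = valℕ p m
        b = valℕ p n
        mn≡ : m * n ≡ p ^ (a + b) * (r * s)
        mn≡ = begin
          m * n                   ≡⟨ cong₂ _*_ m≡ n≡ ⟩
          p ^ a * r * (p ^ b * s) ≡⟨ *-interchange (p ^ a) r (p ^ b) s ⟩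
          p ^ a * p ^ b * (r * s) ≡⟨ cong (_* (r * s)) (^-distribˡ-+-* p a b) ⟨
          p ^ (a + b) * (r * s)   ∎
        p∤rs : p ∤ r * s
        p∤rs = [ p∤r , p∤s ]′ ∘ euclidsLemma r s prime

module IntegersInℚ where

  open import Data.Nat as ℕ using (suc; NonZero)
  import Data.Nat.Properties as ℕ
  import Data.Integer as ℤ
  import Data.Integer.Properties as ℤ
  open import Data.Rational using (mkℚ; 0ℚ; 1ℚ; _+_; _*_; _/_; ↥_; ↧_; toℚᵘ)
  open import Data.Rational.Properties
  open import Data.Rational.Unnormalised as ℚᵘ using (mkℚᵘ; *≡*)
  import Data.Rational.Unnormalised.Properties as ℚᵘ
  open import Relation.Binary.PropositionalEquality

  toℚᵘ-ℤtoℚ : ∀ z → toℚᵘ (ℤtoℚ z) ℚᵘ.≃ mkℚᵘ z 0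
  toℚᵘ-ℤtoℚ z = toℚᵘ-fromℚᵘ (mkℚᵘ z 0)

  ℤtoℚ-injective : ∀ {a b} → ℤtoℚ a ≡ ℤtoℚ b → a ≡ b
  ℤtoℚ-injective {a} {b} eq with ℚᵘ.≃-trans (ℚᵘ.≃-sym (toℚᵘ-ℤtoℚ a)) (ℚᵘ.≃-trans (toℚᵘ-cong eq) (toℚᵘ-ℤtoℚ b))
  ... | *≡* a*1≡b*1 = trans (sym (ℤ.*-identityʳ a)) (trans a*1≡b*1 (ℤ.*-identityʳ b))

  ℕtoℚ-injective : ∀ {m n} → ℕtoℚ m ≡ ℕtoℚ n → m ≡ n
  ℕtoℚ-injective eq = ℤ.+-injective (ℤtoℚ-injective eq)

  ℤtoℚ-+ : ∀ a b → ℤtoℚ (a ℤ.+ b) ≡ ℤtoℚ a + ℤtoℚ b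
  ℤtoℚ-+ a b = toℚᵘ-injective (begin
    toℚᵘ (ℤtoℚ (a ℤ.+ b))           ≈⟨ toℚᵘ-ℤtoℚ (a ℤ.+ b) ⟩
    mkℚᵘ (a ℤ.+ b) 0                ≈⟨ *≡* (cong (ℤ._* + 1) (cong₂ ℤ._+_ (ℤ.*-identityʳ a) (ℤ.*-identityʳ b))) ⟨
    mkℚᵘ a 0 ℚᵘ.+ mkℚᵘ b 0          ≈⟨ ℚᵘ.+-cong (toℚᵘ-ℤtoℚ a) (toℚᵘ-ℤtoℚ b) ⟨
    toℚᵘ (ℤtoℚ a) ℚᵘ.+ toℚᵘ (ℤtoℚ b) ≈⟨ toℚᵘ-homo-+ (ℤtoℚ a) (ℤtoℚ b) ⟨
    toℚᵘ (ℤtoℚ a + ℤtoℚ b)          ∎)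
    where open ℚᵘ.≃-Reasoning

  ℤtoℚ-* : ∀ a b → ℤtoℚ (a ℤ.* b) ≡ ℤtoℚ a * ℤtoℚ b
  ℤtoℚ-* a b = toℚᵘ-injective (begin
    toℚᵘ (ℤtoℚ (a ℤ.* b))           ≈⟨ toℚᵘ-ℤtoℚ (a ℤ.* b) ⟩
    mkℚᵘ a 0 ℚᵘ.* mkℚᵘ b 0          ≈⟨ ℚᵘ.*-cong (toℚᵘ-ℤtoℚ a) (toℚᵘ-ℤtoℚ b) ⟨
    toℚᵘ (ℤtoℚ a) ℚᵘ.* toℚᵘ (ℤtoℚ b) ≈⟨ toℚᵘ-homo-* (ℤtoℚ a) (ℤtoℚ b) ⟨
    toℚᵘ (ℤtoℚ a * ℤtoℚ b)          ∎)
    where open ℚᵘ.≃-Reasoning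

  *-↧≡↥ : ∀ q → q * ℤtoℚ (↧ q) ≡ ℤtoℚ (↥ q)
  *-↧≡↥ q@(mkℚ n d _) = toℚᵘ-injective (begin
    toℚᵘ (q * ℤtoℚ (↧ q))           ≈⟨ toℚᵘ-homo-* q (ℤtoℚ (↧ q)) ⟩
    mkℚᵘ n d ℚᵘ.* toℚᵘ (ℤtoℚ (↧ q)) ≈⟨ ℚᵘ.*-congˡ {mkℚᵘ n d} (toℚᵘ-ℤtoℚ (↧ q)) ⟩
    mkℚᵘ n d ℚᵘ.* mkℚᵘ (↧ q) 0      ≈⟨ *≡* (trans (ℤ.*-identityʳ _) (cong (λ m → n ℤ.* + m) (sym (ℕ.*-identityʳ (suc d))))) ⟩
    mkℚᵘ n 0                        ≈⟨ toℚᵘ-ℤtoℚ n ⟨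
    toℚᵘ (ℤtoℚ (↥ q))               ∎)
    where open ℚᵘ.≃-Reasoning

  1/n*n≡1 : ∀ n .{{_ : NonZero n}} → (+ 1 / n) * ℕtoℚ n ≡ 1ℚ
  1/n*n≡1 n@(suc m) = toℚᵘ-injective (begin
    toℚᵘ ((+ 1 / n) * ℕtoℚ n)  ≈⟨ toℚᵘ-homo-* (+ 1 / n) (ℕtoℚ n) ⟩
    toℚᵘ (+ 1 / n) ℚᵘ.* toℚᵘ (ℕtoℚ n) ≈⟨ ℚᵘ.*-cong (toℚᵘ-fromℚᵘ (mkℚᵘ (+ 1) m)) (toℚᵘ-ℤtoℚ (+ n)) ⟩
    mkℚᵘ (+ 1) m ℚᵘ.* mkℚᵘ (+ n) 0  ≈⟨ *≡* (trans (ℤ.*-identityʳ _) (cong (λ k → + 1 ℤ.* + k) (sym (ℕ.*-identityʳ n)))) ⟩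
    toℚᵘ 1ℚ                         ∎)
    where open ℚᵘ.≃-Reasoning

  *ℕtoℚ≡ℤtoℚ⇒cross : ∀ q {D N} → q * ℕtoℚ D ≡ ℤtoℚ N → ↥ q ℤ.* + D ≡ N ℤ.* ↧ q
  *ℕtoℚ≡ℤtoℚ⇒cross q {D} {N} eq = ℤtoℚ-injective (begin
    ℤtoℚ (↥ q ℤ.* + D)               ≡⟨ ℤtoℚ-* (↥ q) (+ D) ⟩
    ℤtoℚ (↥ q) * ℕtoℚ D              ≡⟨ cong (_* ℕtoℚ D) (*-↧≡↥ q) ⟨
    q * ℤtoℚ (↧ q) * ℕtoℚ D          ≡⟨ *-assoc q _ _ ⟩
    q * (ℤtoℚ (↧ q) * ℕtoℚ D)        ≡⟨ cong (q *_) (*-comm (ℤtoℚ (↧ q)) (ℕtoℚ D)) ⟩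
    q * (ℕtoℚ D * ℤtoℚ (↧ q))        ≡⟨ *-assoc q _ _ ⟨
    q * ℕtoℚ D * ℤtoℚ (↧ q)          ≡⟨ cong (_* ℤtoℚ (↧ q)) eq ⟩
    ℤtoℚ N * ℤtoℚ (↧ q)              ≡⟨ ℤtoℚ-* N (↧ q) ⟨
    ℤtoℚ (N ℤ.* ↧ q)                 ∎)
    where open ≡-Reasoning

  *ℕtoℚ≡ℤtoℚ⇒≢0 : ∀ q {D N} → q * ℕtoℚ D ≡ ℤtoℚ N → N ≢ + 0 → q ≢ 0ℚ
  *ℕtoℚ≡ℤtoℚ⇒≢0 _ {D} eq N≢0 refl = N≢0 (ℤtoℚ-injective (trans (sym eq) (*-zeroˡ (ℕtoℚ D))))

module ValuationOnℚ where

  open import Data.Nat as ℕ using (NonZero)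
  import Data.Nat.Properties as ℕ
  open import Data.Integer as ℤ using (∣_∣; _⊖_)
  import Data.Integer.Properties as ℤ
  open import Data.Rational using (_*_; ↥_; ↧ₙ_)
  open import Function using (_∘_)
  open import Data.Rational.Properties using (↥p≡0⇒p≡0)
  open import Relation.Binary.PropositionalEquality
  open Multiplicity
  open IntegersInℚ

  m+q≡o+n⇒m⊖n≡o⊖q : ∀ m n o q → m ℕ.+ q ≡ o ℕ.+ n → m ⊖ n ≡ o ⊖ q
  m+q≡o+n⇒m⊖n≡o⊖q m n o q eq = begin
    m ⊖ n                   ≡⟨ ℤ.+-cancelˡ-⊖ q m n ⟨
    (q ℕ.+ m) ⊖ (q ℕ.+ n)   ≡⟨ cong₂ _⊖_ (trans (ℕ.+-comm q m) (trans eq (ℕ.+-comm o n))) (ℕ.+-comm q n) ⟩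
    (n ℕ.+ o) ⊖ (n ℕ.+ q)   ≡⟨ ℤ.+-cancelˡ-⊖ n o q ⟩
    o ⊖ q                   ∎
    where open ≡-Reasoning

  module _ {p : ℕ} (prime : Prime p) where

    private instance
      p≢0 : NonZero p
      p≢0 = prime⇒nonZero prime

    ν-p-fraction : ∀ q {D N} → D ≢ 0 → N ≢ + 0 → q * ℕtoℚ D ≡ ℤtoℚ N →
                   ν-p p q ≡ + valℕ p ∣ N ∣ ℤ.- + valℕ p D
    ν-p-fraction q {D} {N} D≢0 N≢0 eq = begin
      ν-p p q                                ≡⟨ ℤ.[+m]-[+n]≡m⊖n (valℕ p ∣ ↥ q ∣) (valℕ p (↧ₙ q)) ⟩
      (valℕ p ∣ ↥ q ∣) ⊖ (valℕ p (↧ₙ q))     ≡⟨ m+q≡o+n⇒m⊖n≡o⊖q (valℕ p ∣ ↥ q ∣) (valℕ p (↧ₙ q)) (valℕ p ∣ N ∣) (valℕ p D) valuations ⟩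
      (valℕ p ∣ N ∣) ⊖ (valℕ p D)           ≡⟨ ℤ.[+m]-[+n]≡m⊖n (valℕ p ∣ N ∣) (valℕ p D) ⟨
      + valℕ p ∣ N ∣ ℤ.- + valℕ p D          ∎
      where
        open ≡-Reasoning
        ∣N∣≢0 : ∣ N ∣ ≢ 0
        ∣N∣≢0 = N≢0 ∘ ℤ.∣i∣≡0⇒i≡0
        ∣↥q∣≢0 : ∣ ↥ q ∣ ≢ 0
        ∣↥q∣≢0 = *ℕtoℚ≡ℤtoℚ⇒≢0 q {D} {N} eq N≢0 ∘ ↥p≡0⇒p≡0 q ∘ ℤ.∣i∣≡0⇒i≡0
        cross : ∣ ↥ q ∣ ℕ.* D ≡ ∣ N ∣ ℕ.* ↧ₙ q
        cross = trans (sym (ℤ.abs-* (↥ q) (+ D))) (trans (cong ∣_∣ (*ℕtoℚ≡ℤtoℚ⇒cross q {D} {N} eq)) (ℤ.abs-* N (ℤ.+ ↧ₙ q)))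
        valuations : valℕ p ∣ ↥ q ∣ ℕ.+ valℕ p D ≡ valℕ p ∣ N ∣ ℕ.+ valℕ p (↧ₙ q)
        valuations = trans (sym (valℕ-* prime ∣↥q∣≢0 D≢0)) (trans (cong (valℕ p) cross) (valℕ-* prime ∣N∣≢0 (λ ())))

module Periodicity where

  open import Data.Nat using (_+_; _<_)
  open import Data.Nat.Properties using (+-identityʳ)
  open import Data.Product using (_,_)
  open import Relation.Binary.PropositionalEquality

  periodicOfPeriod-∘ : ∀ {A B : Set} {s : ℕ → A} {t : ℕ → B} {k} (f : A → B) →
    1 ≤ k → (∀ i → t i ≡ f (s i)) → HasPeriod s k →
    (∀ j → 1 ≤ j → j < k → f (s j) ≢ f (s 0)) → PeriodicOfPeriod t k
  periodicOfPeriod-∘ {s = s} {t} {k} f 1≤k t≡fs s-period fs≢fs₀ =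
    1≤k , t-period , λ j 1≤j j<k j-period → fs≢fs₀ j 1≤j j<k (begin
      f (s j)   ≡⟨ t≡fs j ⟨
      t j       ≡⟨ cong t (+-identityʳ j) ⟨
      t (j + 0) ≡⟨ j-period 0 ⟩
      t 0       ≡⟨ t≡fs 0 ⟩
      f (s 0)   ∎)
    where
      open ≡-Reasoning
      t-period : HasPeriod t k
      t-period i = begin
        t (k + i)     ≡⟨ t≡fs (k + i) ⟩
        f (s (k + i)) ≡⟨ cong f (s-period i) ⟩
        f (s i)       ≡⟨ t≡fs i ⟨
        t i           ∎

module Countdown (k′ : ℕ) where

  open import Data.Nat using (zero; _+_; _∸_; _<_; s≤s; z≤n)
  open import Data.Nat.Properties using (≤-refl; <⇒≤; +-identityʳ; +-suc; +-∸-assoc; n∸n≡0; m>n⇒m∸n≢0)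
  open import Data.Integer as ℤ using (ℤ; -[1+_])
  open import Relation.Binary.PropositionalEquality

  step : ℕ → ℕ
  step zero    = k′
  step (suc m) = m

  jump : ℕ → ℤ
  jump zero    = + k′
  jump (suc _) = -[1+ 0 ]

  step≡m+jump : ∀ m → + step m ≡ + m ℤ.+ jump m
  step≡m+jump zero    = refl
  step≡m+jump (suc m) = refl

  step-≤ : ∀ {m} → m ≤ k′ → step m ≤ k′
  step-≤ {zero}  _    = ≤-refl
  step-≤ {suc _} m<k′ = <⇒≤ m<k′

  orbit : ℕ → ℕ
  orbit zero    = 0
  orbit (suc i) = step (orbit i)

  orbit-≤ : ∀ i → orbit i ≤ k′
  orbit-≤ zero    = z≤n
  orbit-≤ (suc i) = step-≤ (orbit-≤ i)

  orbit-suc : ∀ {j} → j ≤ k′ → orbit (suc j) ≡ k′ ∸ j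
  orbit-suc {zero}  _     = refl
  orbit-suc {suc j} j<k′ rewrite orbit-suc (<⇒≤ j<k′) | +-∸-assoc 1 j<k′ = refl

  orbit-period : HasPeriod orbit (suc k′)
  orbit-period zero    = trans (cong orbit (+-identityʳ (suc k′))) (trans (orbit-suc ≤-refl) (n∸n≡0 k′))
  orbit-period (suc i) = trans (cong orbit (+-suc (suc k′) i)) (cong step (orbit-period i))

  orbit≢0 : ∀ j → 1 ≤ j → j < suc k′ → orbit j ≢ 0
  orbit≢0 (suc j) _ (s≤s j<k′) = subst (_≢ 0) (sym (orbit-suc (<⇒≤ j<k′))) (m>n⇒m∸n≢0 j<k′)

  jump≡jump[0]⇒≡0 : ∀ {m} → jump m ≡ jump 0 → m ≡ 0
  jump≡jump[0]⇒≡0 {zero}  _  = refl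
  jump≡jump[0]⇒≡0 {suc _} ()

module ShiftedValuation {p : ℕ} (prime : Prime p) (b : ℚ) (b≢0 : b ≢ 0ℚ)
         (ν-p[b]≡0 : ν-p p {{prime⇒nonZero prime}} b ≡ + 0)
         (k′ : ℕ) (k≤p : suc k′ ≤ p) where

  open import Data.Nat as ℕ using (zero; NonZero; _<_; s≤s)
  import Data.Nat.Properties as ℕ
  open import Data.Nat.Divisibility using (_∣_; _∤_; m∣m*n; ∣⇒≤; _∣0)
  open import Data.Nat.Primality using (prime⇒nonTrivial; euclidsLemma)
  import Data.Nat.Coprimality as Coprimality
  open import Data.Integer as ℤ using (ℤ; ∣_∣)
  import Data.Integer.Properties as ℤ
  import Data.Integer.Divisibility.Signed as ℤ
  open import Data.Rational using (mkℚ; 1ℚ; _+_; _*_; _/_; ↥_; ↧_; ↧ₙ_)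
  open import Data.Rational.Properties using (*-identityʳ; ↥p≡0⇒p≡0)
  open import Data.Rational.Solver using (module +-*-Solver)
  open import Data.Product using (_×_; _,_)
  open import Data.Sum using ([_,_]′)
  open import Function using (_∘_)
  open import Relation.Binary.PropositionalEquality
  open Multiplicity
  open IntegersInℚ
  open ValuationOnℚ

  open Countdown k′

  private instance
    p≢0 : NonZero p
    p≢0 = prime⇒nonZero prime

  private
    1<p : 1 < p
    1<p = ℕ.nonTrivial⇒n>1 p {{prime⇒nonTrivial prime}}

    coprime : Coprimality.Coprime ∣ ↥ b ∣ (↧ₙ b)
    coprime = coprimeOf b
      where
        coprimeOf : ∀ q → Coprimality.Coprime ∣ ↥ q ∣ (↧ₙ q)
        coprimeOf (mkℚ _ _ c) = Coprimality.recompute c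

    valℕ-↥b≡valℕ-↧b : valℕ p ∣ ↥ b ∣ ≡ valℕ p (↧ₙ b)
    valℕ-↥b≡valℕ-↧b = ℤ.+-injective (ℤ.i-j≡0⇒i≡j _ _ ν-p[b]≡0)

  p∤↥b : p ∤ ∣ ↥ b ∣
  p∤↥b = coprime⇒valℕ≡⇒∤ 1<p coprime (b≢0 ∘ ↥p≡0⇒p≡0 b ∘ ℤ.∣i∣≡0⇒i≡0) valℕ-↥b≡valℕ-↧b

  p∤↧b : p ∤ ↧ₙ b
  p∤↧b = coprime⇒valℕ≡⇒∤ 1<p (Coprimality.sym coprime) (λ ()) (sym valℕ-↥b≡valℕ-↧b)

  v₀ : ℚ
  v₀ = b * ℕtoℚ (p ^ suc k′)

  shiftedNumerator : ℕ → ℤ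
  shiftedNumerator m = ↥ b ℤ.* + p ^ suc k′ ℤ.+ + m ℤ.* ↧ b

  shifted-cleared : ∀ m → (v₀ + ℕtoℚ m) * (+ 1 / p) * ℕtoℚ (↧ₙ b ℕ.* p) ≡ ℤtoℚ (shiftedNumerator m)
  shifted-cleared m = begin
    (b * P + M) * (+ 1 / p) * ℕtoℚ (↧ₙ b ℕ.* p)         ≡⟨ cong ((b * P + M) * (+ 1 / p) *_) (trans (cong ℤtoℚ (ℤ.pos-* (↧ₙ b) p)) (ℤtoℚ-* (↧ b) (+ p))) ⟩
    (b * P + M) * (+ 1 / p) * (ℤtoℚ (↧ b) * ℕtoℚ p)     ≡⟨ solve 6 (λ B P M I Q R → (B :* P :+ M) :* I :* (Q :* R) := (B :* Q :* P :+ M :* Q) :* (I :* R)) refl b P M (+ 1 / p) (ℤtoℚ (↧ b)) (ℕtoℚ p) ⟩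
    (b * ℤtoℚ (↧ b) * P + M * ℤtoℚ (↧ b)) * ((+ 1 / p) * ℕtoℚ p) ≡⟨ cong₂ (λ x y → (x * P + M * ℤtoℚ (↧ b)) * y) (*-↧≡↥ b) (1/n*n≡1 p) ⟩
    (ℤtoℚ (↥ b) * P + M * ℤtoℚ (↧ b)) * 1ℚ             ≡⟨ *-identityʳ _ ⟩
    ℤtoℚ (↥ b) * P + M * ℤtoℚ (↧ b)                   ≡⟨ cong₂ _+_ (ℤtoℚ-* (↥ b) (+ p ^ suc k′)) (ℤtoℚ-* (+ m) (↧ b)) ⟨
    ℤtoℚ (↥ b ℤ.* + p ^ suc k′) + ℤtoℚ (+ m ℤ.* ↧ b)    ≡⟨ ℤtoℚ-+ (↥ b ℤ.* + p ^ suc k′) (+ m ℤ.* ↧ b) ⟨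
    ℤtoℚ (shiftedNumerator m)                          ∎
    where
      open ≡-Reasoning
      open +-*-Solver
      P M : ℚ
      P = ℕtoℚ (p ^ suc k′)
      M = ℕtoℚ m

  ∣shiftedNumerator0∣ : ∣ shiftedNumerator 0 ∣ ≡ p ^ suc k′ ℕ.* ∣ ↥ b ∣
  ∣shiftedNumerator0∣ = begin
    ∣ shiftedNumerator 0 ∣        ≡⟨ cong ∣_∣ (ℤ.+-identityʳ (↥ b ℤ.* + p ^ suc k′)) ⟩
    ∣ ↥ b ℤ.* + p ^ suc k′ ∣      ≡⟨ ℤ.abs-* (↥ b) (+ p ^ suc k′) ⟩
    ∣ ↥ b ∣ ℕ.* p ^ suc k′        ≡⟨ ℕ.*-comm ∣ ↥ b ∣ (p ^ suc k′) ⟩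
    p ^ suc k′ ℕ.* ∣ ↥ b ∣        ∎
    where open ≡-Reasoning

  p∤shiftedNumerator : ∀ {m} → suc m < p → p ∤ ∣ shiftedNumerator (suc m) ∣
  p∤shiftedNumerator {m} m<p p∣N =
    [ (λ p∣m → ℕ.<⇒≱ m<p (∣⇒≤ p∣m)) , p∤↧b ]′ (euclidsLemma (suc m) (↧ₙ b) prime p∣m*↧b)
    where
      p∣↥b*p^k : + p ℤ.∣ ↥ b ℤ.* + p ^ suc k′
      p∣↥b*p^k = ℤ.∣n⇒∣m*n (↥ b) (ℤ.∣ᵤ⇒∣ (m∣m*n (p ^ k′)))
      p∣m*↧b : p ∣ suc m ℕ.* ↧ₙ b
      p∣m*↧b = subst (p ∣_) (ℤ.abs-* (+ suc m) (↧ b))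
                 (ℤ.∣⇒∣ᵤ (ℤ.∣m+n∣m⇒∣n (ℤ.∣ᵤ⇒∣ p∣N) p∣↥b*p^k))

  shiftedNumerator≢0 : ∀ {m} → m ≤ k′ → shiftedNumerator m ≢ + 0
  shiftedNumerator≢0 {zero} _ N≡0 =
    p^a*r≢0 1<p (suc k′) p∤↥b (trans (sym ∣shiftedNumerator0∣) (cong ∣_∣ N≡0))
  shiftedNumerator≢0 {suc m} m<k′ N≡0 =
    p∤shiftedNumerator (ℕ.<-≤-trans (s≤s m<k′) k≤p) (subst (λ N → p ∣ ∣ N ∣) (sym N≡0) (p ∣0))

  valℕ-↧b*p : valℕ p (↧ₙ b ℕ.* p) ≡ 1
  valℕ-↧b*p = valℕ-unique 1<p 1 (trans (ℕ.*-comm (↧ₙ b) p) (cong (ℕ._* ↧ₙ b) (sym (ℕ.*-identityʳ p)))) p∤↧b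

  valℕ-gap≡jump : ∀ {m} → m ≤ k′ →
    + valℕ p ∣ shiftedNumerator m ∣ ℤ.- + valℕ p (↧ₙ b ℕ.* p) ≡ jump m
  valℕ-gap≡jump {zero} _
    rewrite valℕ-unique 1<p (suc k′) ∣shiftedNumerator0∣ p∤↥b | valℕ-↧b*p = refl
  valℕ-gap≡jump {suc m} m<k′
    rewrite ∤⇒valℕ≡0 1<p (p∤shiftedNumerator (ℕ.<-≤-trans (s≤s m<k′) k≤p)) | valℕ-↧b*p = refl

  ν-p-shift : ∀ {m} → m ≤ k′ →
    (v₀ + ℕtoℚ m) * (+ 1 / p) ≢ 0ℚ × ν-p p ((v₀ + ℕtoℚ m) * (+ 1 / p)) ≡ jump m
  ν-p-shift {m} m≤k′ =
    *ℕtoℚ≡ℤtoℚ⇒≢0 q {↧ₙ b ℕ.* p} (shifted-cleared m) (shiftedNumerator≢0 m≤k′) ,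
    trans (ν-p-fraction prime q ↧b*p≢0 (shiftedNumerator≢0 m≤k′) (shifted-cleared m)) (valℕ-gap≡jump m≤k′)
    where
      q : ℚ
      q = (v₀ + ℕtoℚ m) * (+ 1 / p)
      ↧b*p≢0 : ↧ₙ b ℕ.* p ≢ 0
      ↧b*p≢0 = ℕ.≢-nonZero⁻¹ (↧ₙ b ℕ.* p) {{ℕ.m*n≢0 (↧ₙ b) p}}

module ValuedField {p : ℕ} (K : PAdicValuedField p) where

  open import Data.Nat using (NonZero)
  open import Data.Rational using (1ℚ; _+_; _*_; _/_; 1/_; ≢-nonZero)
  open import Data.Rational.Properties using (*-inverseʳ)
  open import Data.Product using (_×_; _,_)
  import Relation.Binary.PropositionalEquality as ≡
  open PAdicValuedField K
  open import Relation.Binary.Reasoning.Setoid setoid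

  ι-≉0 : ∀ {q} → q ≢ 0ℚ → ¬ (ι q ≈ 0K)
  ι-≉0 {q} q≢0 ιq≈0 = 1≉0 (begin
    1K                   ≈⟨ ι-1 ⟨
    ι 1ℚ                 ≡⟨ ≡.cong ι (*-inverseʳ q) ⟨
    ι (q * 1/ q)         ≈⟨ ι-* q (1/ q) ⟩
    ι q *K ι (1/ q)      ≈⟨ *-congʳ ιq≈0 ⟩
    0K *K ι (1/ q)       ≈⟨ zeroˡ (ι (1/ q)) ⟩
    0K                   ∎)
    where instance _ = ≢-nonZero q≢0

  *-≉0 : ∀ {x y} → ¬ (x ≈ 0K) → ¬ (y ≈ 0K) → ¬ ((x *K y) ≈ 0K)
  *-≉0 {x} {y} x≉0 y≉0 xy≈0 with inverse y y≉0
  ... | y⁻¹ , yy⁻¹≈1 = x≉0 (begin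
    x                  ≈⟨ *-identityʳ x ⟨
    x *K 1K            ≈⟨ *-congˡ yy⁻¹≈1 ⟨
    x *K (y *K y⁻¹)    ≈⟨ *-assoc x y y⁻¹ ⟨
    (x *K y) *K y⁻¹    ≈⟨ *-congʳ xy≈0 ⟩
    0K *K y⁻¹          ≈⟨ zeroˡ y⁻¹ ⟩
    0K                 ∎)

  module _ (prime : Prime p) where

    private instance
      p≢0 : NonZero p
      p≢0 = prime⇒nonZero prime

    ν-D : ∀ {y v} → ¬ (y ≈ 0K) → ν y ≡ v → v * (+ 1 / p) ≢ 0ℚ →
          ¬ (D prime K y ≈ 0K) × ν (D prime K y) ≡ v + ℤtoℚ (ν-p p (v * (+ 1 / p)))
    ν-D {y} y≉0 ≡.refl v/p≢0 =
      *-≉0 y≉0 (ι-≉0 v/p≢0) ,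
      ≡.trans (ν-* y _ y≉0 (ι-≉0 v/p≢0)) (≡.cong (λ z → ν y + z) (ν-ext prime _ v/p≢0))

module Trajectory {p : ℕ} (prime : Prime p) (K : PAdicValuedField p)
  (x : PAdicValuedField.Carrier K) (x≉0 : ¬ (PAdicValuedField._≈_ K x (PAdicValuedField.0K K)))
  (b : ℚ) (b≢0 : b ≢ 0ℚ) (ν-p[b]≡0 : ν-p p {{prime⇒nonZero prime}} b ≡ + 0)
  (k′ : ℕ) (k≤p : suc k′ ≤ p)
  (νx≡bp^k : PAdicValuedField.ν K x ≡ b ℚ.* ℕtoℚ (p ^ suc k′)) where

  open import Data.Nat using (zero; NonZero; s≤s; z≤n)
  import Data.Integer as ℤ
  open import Data.Rational using (_+_; _-_; _*_; _/_)
  open import Data.Rational.Properties using (+-identityʳ; +-assoc; +-0-abelianGroup)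
  open import Algebra.Properties.AbelianGroup +-0-abelianGroup using (∙-cancelˡ; xyx⁻¹≈y)
  open import Data.Product using (_×_; _,_; proj₁; proj₂)
  open import Function using (_∘_)
  open import Relation.Binary.PropositionalEquality
  open IntegersInℚ using (ℤtoℚ-+; ℤtoℚ-injective; ℕtoℚ-injective)
  open Periodicity

  open PAdicValuedField K using (_≈_; 0K; ν)
  open Countdown k′
  open ShiftedValuation prime b b≢0 ν-p[b]≡0 k′ k≤p using (v₀; ν-p-shift)
  open ValuedField K using (ν-D)

  private instance
    p≢0 : NonZero p
    p≢0 = prime⇒nonZero prime

  ν-D-above-v₀ : ∀ {y m} → ¬ (y ≈ 0K) → m ≤ k′ → ν y ≡ v₀ + ℕtoℚ m →
                 ¬ (D prime K y ≈ 0K) × ν (D prime K y) ≡ (v₀ + ℕtoℚ m) + ℤtoℚ (jump m)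
  ν-D-above-v₀ {y} {m} y≉0 m≤k′ νy≡ =
    proj₁ Dy , trans (proj₂ Dy) (cong (λ z → (v₀ + ℕtoℚ m) + ℤtoℚ z) (proj₂ (ν-p-shift m≤k′)))
    where
      Dy : ¬ (D prime K y ≈ 0K) × ν (D prime K y) ≡ (v₀ + ℕtoℚ m) + ℤtoℚ (ν-p p ((v₀ + ℕtoℚ m) * (+ 1 / p)))
      Dy = ν-D prime y≉0 νy≡ (proj₁ (ν-p-shift m≤k′))

  shift-by-jump : ∀ m → (v₀ + ℕtoℚ m) + ℤtoℚ (jump m) ≡ v₀ + ℕtoℚ (step m)
  shift-by-jump m = begin
    (v₀ + ℕtoℚ m) + ℤtoℚ (jump m)   ≡⟨ +-assoc v₀ (ℕtoℚ m) (ℤtoℚ (jump m)) ⟩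
    v₀ + (ℕtoℚ m + ℤtoℚ (jump m))   ≡⟨ cong (λ z → v₀ + z) (ℤtoℚ-+ (+ m) (jump m)) ⟨
    v₀ + ℤtoℚ (+ m ℤ.+ jump m)      ≡⟨ cong (λ z → v₀ + ℤtoℚ z) (step≡m+jump m) ⟨
    v₀ + ℕtoℚ (step m)              ∎
    where open ≡-Reasoning

  ν-iterD      : ∀ i → ¬ (iterD prime K i x ≈ 0K) × νSeq prime K x i ≡ v₀ + ℕtoℚ (orbit i)
  ν-iterD-step : ∀ i → ¬ (iterD prime K (suc i) x ≈ 0K) ×
                 νSeq prime K x (suc i) ≡ (v₀ + ℕtoℚ (orbit i)) + ℤtoℚ (jump (orbit i))

  ν-iterD zero    = x≉0 , trans νx≡bp^k (sym (+-identityʳ v₀))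
  ν-iterD (suc i) = proj₁ (ν-iterD-step i) , trans (proj₂ (ν-iterD-step i)) (shift-by-jump (orbit i))

  ν-iterD-step i = ν-D-above-v₀ (proj₁ (ν-iterD i)) (orbit-≤ i) (proj₂ (ν-iterD i))

  incSeq≡jump : ∀ i → incSeq prime K x i ≡ ℤtoℚ (jump (orbit i))
  incSeq≡jump i = begin
    νSeq prime K x (suc i) - νSeq prime K x i  ≡⟨ cong₂ _-_ (proj₂ (ν-iterD-step i)) (proj₂ (ν-iterD i)) ⟩
    (v + ℤtoℚ (jump (orbit i))) - v            ≡⟨ xyx⁻¹≈y v (ℤtoℚ (jump (orbit i))) ⟩
    ℤtoℚ (jump (orbit i))                      ∎
    where
      open ≡-Reasoning
      v : ℚ
      v = v₀ + ℕtoℚ (orbit i)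

  νSeq-periodic : PeriodicOfPeriod (νSeq prime K x) (suc k′)
  νSeq-periodic = periodicOfPeriod-∘ (λ m → v₀ + ℕtoℚ m) (s≤s z≤n) (proj₂ ∘ ν-iterD) orbit-period
    λ j 1≤j j<k → orbit≢0 j 1≤j j<k ∘ ℕtoℚ-injective ∘ ∙-cancelˡ v₀ _ _

  incSeq-periodic : PeriodicOfPeriod (incSeq prime K x) (suc k′)
  incSeq-periodic = periodicOfPeriod-∘ (ℤtoℚ ∘ jump) (s≤s z≤n) incSeq≡jump orbit-period
    λ j 1≤j j<k → orbit≢0 j 1≤j j<k ∘ jump≡jump[0]⇒≡0 ∘ ℤtoℚ-injective

open import Data.Nat using (zero)
open import Data.Rational using (_*_)
open import Data.Product using (_×_; _,_)

corollary2p6 : (p : ℕ) (hp : Prime p) (K : PAdicValuedField p)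
    (x : PAdicValuedField.Carrier K) → ¬ (PAdicValuedField._≈_ K x (PAdicValuedField.0K K)) →
    (b : ℚ) → b ≢ 0ℚ → ν-p p {{prime⇒nonZero hp}} b ≡ + 0 →
    (k : ℕ) → 1 ≤ k → k ≤ p →
    PAdicValuedField.ν K x ≡ b * ℕtoℚ (p ^ k) →
    PeriodicOfPeriod (νSeq hp K x) k × PeriodicOfPeriod (incSeq hp K x) k
corollary2p6 p hp K x x≉0 b b≢0 ν-p[b]≡0 zero () _ _
corollary2p6 p hp K x x≉0 b b≢0 ν-p[b]≡0 (suc k′) _ k≤p νx≡bp^k =
  νSeq-periodic , incSeq-periodic
  where open Trajectory hp K x x≉0 b b≢0 ν-p[b]≡0 k′ k≤p νx≡bp^k
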